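{- Let $G$ be a tree-path intersection graph. If $s_1,s_2$ are adjacent in $T_H$ or in $T_V$, then $\Gamma(s_1)\cap\Gamma(s_2)\neq\emptyset$.
   Context: A tree-path intersection graph is a connected bipartite graph $G$ with disjoint parts $G_H$, $G_V$, together with a tree $T_H$ on vertex set $G_H$ and a tree $T_V$ on vertex set $G_V$, such that for every $h\in G_H$ the neighbourhood $\Gamma(h)$ of $h$ in $G$ is the vertex set of a path in $T_V$, and for every $v\in G_V$ the neighbourhood $\Gamma(v)$ is the vertex set of a path in $T_H$. -}

module Defs where

open import Data.Nat using (ℕ; _≤_)
open import Data.Fin using (Fin)
open import Data.List using (List; []; _∷_; length; _∷ʳ_)
open import Data.List.Membership.Propositional using (_∈_)
open import Data.List.Relation.Unary.Unique.Propositional using (Unique)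
open import Data.List.Relation.Unary.Linked using (Linked)
open import Data.Sum using (_⊎_; inj₁; inj₂)
open import Data.Product using (Σ; _×_; ∃-syntax)
open import Data.Empty using (⊥)
open import Function.Bundles using (_⇔_)
open import Relation.Nullary using (¬_)
open import Relation.Binary.Construct.Closure.ReflexiveTransitive using (Star)

Rel : Set → Set₁
Rel A = A → A → Set

Connected : {A : Set} → Rel A → Set
Connected {A} R = (x y : A) → Star R x y

HasCycle : {A : Set} → Rel A → Set
HasCycle {A} R =
  Σ A λ x → Σ (List A) λ ys →
    (2 ≤ length ys) × Unique (x ∷ ys) × Linked R ((x ∷ ys) ∷ʳ x)

record IsTree {A : Set} (R : Rel A) : Set where
  field
    sym     : ∀ {x y} → R x y → R y x
    irrefl  : ∀ {x} → R x x → ⊥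
    connected : Connected R
    acyclic : ¬ HasCycle R

IsPathVertexSet : {A : Set} → Rel A → (A → Set) → Set
IsPathVertexSet {A} R S =
  Σ A λ x → Σ (List A) λ xs →
    Unique (x ∷ xs) × Linked R (x ∷ xs) × (∀ v → (v ∈ (x ∷ xs)) ⇔ S v)

BipAdj : {H V : Set} → (H → V → Set) → Rel (H ⊎ V)
BipAdj E (inj₁ h) (inj₂ v) = E h v
BipAdj E (inj₂ v) (inj₁ h) = E h v
BipAdj E (inj₁ _) (inj₁ _) = ⊥
BipAdj E (inj₂ _) (inj₂ _) = ⊥

-- A tree-path intersection graph with parts G_H = Fin nH and G_V = Fin nV.
record TreePathIntersectionGraph (nH nV : ℕ) : Set₁ where
  field
    E  : Fin nH → Fin nV → Set
    TH : Rel (Fin nH)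
    TV : Rel (Fin nV)
    G-connected : Connected (BipAdj E)
    TH-tree : IsTree TH
    TV-tree : IsTree TV
    Γh-path : (h : Fin nH) → IsPathVertexSet TV (λ v → E h v)
    Γv-path : (v : Fin nV) → IsPathVertexSet TH (λ h → E h v)

{-# OPTIONS --safe #-}
module Submission where

-- Call a tree edge covered if both ends lie on one common path. Two vertices of
-- the tree with a common neighbour w lie on the path Γ(w), so each step of a
-- walk in G yields a walk of covered tree edges; by connectedness of G any two
-- tree vertices are joined by such a walk. For an edge s₁ s₂, a covered walk
-- from s₁ to s₂ avoiding that edge would close a cycle in the tree, so the walk
-- uses it, i.e. Γ(s₁) ∩ Γ(s₂) is nonempty.

open import Defs
open import Data.Nat using (ℕ; s≤s; z≤n)
open import Data.Fin using (Fin)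
open import Data.Fin.Properties using (_≟_)
open import Data.Product using (_×_; _,_; ∃-syntax; ∃₂)
open import Data.Sum using (_⊎_; inj₁; inj₂; swap)
open import Data.Empty using (⊥-elim)
open import Data.List using (List; []; _∷_; _∷ʳ_)
open import Data.List.Membership.Propositional using (_∈_)
import Data.List.Membership.DecPropositional as DecMembership
open import Data.List.Relation.Unary.Any using (here; there)
open import Data.List.Relation.Unary.All using ([])
open import Data.List.Relation.Unary.All.Properties using (¬Any⇒All¬)
open import Data.List.Relation.Unary.AllPairs using ([]; _∷_)
open import Data.List.Relation.Unary.Unique.Propositional using (Unique)
open import Data.List.Relation.Unary.Linked using (Linked; []; [-]; _∷_)
import Data.List.Relation.Unary.Linked as Linked
open import Function using (flip)
open import Function.Bundles using (Equivalence)
open import Relation.Nullary using (¬_; yes; no)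
open import Relation.Nullary.Decidable using (_×-dec_; _⊎-dec_)
open import Relation.Binary.Definitions using (DecidableEquality; Decidable; Symmetric)
open import Relation.Binary.PropositionalEquality using (_≡_; refl)
open import Relation.Binary.Construct.Intersection using (_∩_)
open import Relation.Binary.Construct.Closure.ReflexiveTransitive
  using (Star; ε; _◅_; _◅◅_; gmap; reverse) renaming (map to star-map)

data Last {A : Set} (b : A) : List A → Set where
  end  : Last b (b ∷ [])
  step : ∀ {x l} → Last b l → Last b (x ∷ l)

record SimplePath {A : Set} (R : Rel A) (a b : A) : Set where
  constructor simplePath
  field
    rest   : List A
    linked : Linked R (a ∷ rest)
    unique : Unique (a ∷ rest)
    last   : Last b (a ∷ rest)

linked-∷ʳ : ∀ {A : Set} {R : Rel A} {b c l} →
            Linked R l → Last b l → R b c → Linked R (l ∷ʳ c)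
linked-∷ʳ [-]      end      r = r ∷ [-]
linked-∷ʳ (s ∷ lk) (step l) r = s ∷ linked-∷ʳ lk l r

linked⇒star : ∀ {A : Set} {R : Rel A} {x xs a} →
              Linked R (x ∷ xs) → a ∈ x ∷ xs → Star R x a
linked⇒star _        (here refl) = ε
linked⇒star (r ∷ lk) (there a∈)  = r ◅ linked⇒star lk a∈

module _ {A : Set} (_≟_ : DecidableEquality A) {R : Rel A} where
  open DecMembership _≟_ using (_∈?_)

  suffix-simplePath : ∀ {a b l} → a ∈ l → Linked R l → Unique l → Last b l →
                      SimplePath R a b
  suffix-simplePath {l = _ ∷ xs} (here refl) lk u l = simplePath xs lk u l
  suffix-simplePath (there a∈) (_ ∷ lk) (_ ∷ u) (step l) =
    suffix-simplePath a∈ lk u l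

  -- If a reappears on the path from y, the loop through a is dropped.
  star⇒simplePath : ∀ {a b} → Star R a b → SimplePath R a b
  star⇒simplePath ε = simplePath [] [-] ([] ∷ []) end
  star⇒simplePath {a} (_◅_ {j = y} r w) with star⇒simplePath w
  ... | simplePath ys lk u l with a ∈? (y ∷ ys)
  ...   | yes a∈ = suffix-simplePath a∈ lk u l
  ...   | no a∉  = simplePath (y ∷ ys) (r ∷ lk) (¬Any⇒All¬ (y ∷ ys) a∉ ∷ u) (step l)

_∖_ : {A : Set} → Rel A → Rel A → Rel A
(R ∖ P) x y = R x y × ¬ P x y

split-walk : ∀ {A : Set} {R P : Rel A} → Decidable P →
             ∀ {a b} → Star R a b → ∃₂ (λ x y → R x y × P x y) ⊎ Star (R ∖ P) a b
split-walk P? ε = inj₂ ε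
split-walk P? (_◅_ {i = x} {j = y} r w) with P? x y
... | yes p = inj₁ (x , y , r , p)
... | no ¬p with split-walk P? w
...   | inj₁ found = inj₁ found
...   | inj₂ w′    = inj₂ ((r , ¬p) ◅ w′)

Crosses : {A : Set} → A → A → Rel A
Crosses h₁ h₂ x y = (x ≡ h₁ × y ≡ h₂) ⊎ (x ≡ h₂ × y ≡ h₁)

crosses? : ∀ {A : Set} → DecidableEquality A → ∀ {h₁ h₂} → Decidable (Crosses h₁ h₂)
crosses? _≟_ {h₁} {h₂} x y = ((x ≟ h₁) ×-dec (y ≟ h₂)) ⊎-dec ((x ≟ h₂) ×-dec (y ≟ h₁))

module _ {A : Set} (_≟_ : DecidableEquality A) {T : Rel A} (tree : IsTree T) where
  open IsTree tree

  -- A detour from h₁ to h₂ closes a cycle with the edge h₂ h₁.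
  tree-edge-bridge : ∀ {h₁ h₂} → T h₁ h₂ → ¬ Star (T ∖ Crosses h₁ h₂) h₁ h₂
  tree-edge-bridge {h₁} t w with star⇒simplePath _≟_ w
  ... | simplePath [] _ _ end = irrefl t
  ... | simplePath (_ ∷ []) ((_ , ¬cross) ∷ _) _ (step end) = ¬cross (inj₁ (refl , refl))
  ... | simplePath ys@(_ ∷ _ ∷ _) lk u l =
    acyclic (h₁ , ys , s≤s (s≤s z≤n) , u , linked-∷ʳ (Linked.map (λ (r , _) → r) lk) l (sym t))

Covered : {A B : Set} → (A → B → Set) → Rel A
Covered F x y = ∃[ w ] (F x w × F y w)

module _ {A B : Set} (F : A → B → Set) {T : Rel A} where

  covered-linked : ∀ {w l} → Linked T l → (∀ {z} → z ∈ l → F z w) →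
                   Linked (T ∩ Covered F) l
  covered-linked []       _ = []
  covered-linked [-]      _ = [-]
  covered-linked {w} (r ∷ lk) inF =
    (r , w , inF (here refl) , inF (there (here refl))) ∷ covered-linked lk (λ z∈ → inF (there z∈))

  module _ (T-sym : Symmetric T) (paths : ∀ w → IsPathVertexSet T (λ a → F a w)) where

    covered-symmetric : Symmetric (T ∩ Covered F)
    covered-symmetric (r , w , fx , fy) = T-sym r , w , fy , fx

    path-walk : ∀ {w a c} → F a w → F c w → Star (T ∩ Covered F) a c
    path-walk {w} fa fc with paths w
    ... | _ , _ , _ , lk , iff =
      reverse covered-symmetric (linked⇒star lk′ (member fa)) ◅◅ linked⇒star lk′ (member fc)
      where
      lk′ : Linked (T ∩ Covered F) _
      lk′ = covered-linked lk (Equivalence.to (iff _))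
      member : ∀ {z} → F z w → z ∈ _
      member {z} = Equivalence.from (iff z)

    bipartite-walk⇒covered-walk : ∀ {a b} →
      Star (BipAdj F) (inj₁ a) (inj₁ b) → Star (T ∩ Covered F) a b
    covered-walk-via : ∀ {a w b} → F a w →
      Star (BipAdj F) (inj₂ w) (inj₁ b) → Star (T ∩ Covered F) a b

    bipartite-walk⇒covered-walk ε = ε
    bipartite-walk⇒covered-walk (_◅_ {j = inj₂ _} f w) = covered-walk-via f w
    covered-walk-via fa (_◅_ {j = inj₁ _} f w) = path-walk fa f ◅◅ bipartite-walk⇒covered-walk w

tree-edge-covered : ∀ {A B : Set} {T : Rel A} {F : A → B → Set} →
  DecidableEquality A → IsTree T → (∀ w → IsPathVertexSet T (λ a → F a w)) →
  (∀ a b → Star (BipAdj F) (inj₁ a) (inj₁ b)) →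
  ∀ {h₁ h₂} → T h₁ h₂ → Covered F h₁ h₂
tree-edge-covered {F = F} _≟_ tree paths connected {h₁} {h₂} t
  with split-walk (crosses? _≟_)
         (bipartite-walk⇒covered-walk F (IsTree.sym tree) paths (connected h₁ h₂))
... | inj₁ (_ , _ , (_ , w , f₁ , f₂) , inj₁ (refl , refl)) = w , f₁ , f₂
... | inj₁ (_ , _ , (_ , w , f₂ , f₁) , inj₂ (refl , refl)) = w , f₁ , f₂
... | inj₂ detour =
  ⊥-elim (tree-edge-bridge _≟_ tree t (star-map (λ ((r , _) , ¬c) → r , ¬c) detour))

BipAdj-swap : ∀ {H V : Set} (E : H → V → Set) {x y} →
              BipAdj E x y → BipAdj (flip E) (swap x) (swap y)
BipAdj-swap _ {x = inj₁ _} {inj₂ _} e = e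
BipAdj-swap _ {x = inj₂ _} {inj₁ _} e = e

lemma6 : {nH nV : ℕ} (G : TreePathIntersectionGraph nH nV) →
    let open TreePathIntersectionGraph G in
    ((s₁ s₂ : Fin nH) → TH s₁ s₂ → ∃[ v ] (E s₁ v × E s₂ v))
    × ((s₁ s₂ : Fin nV) → TV s₁ s₂ → ∃[ h ] (E h s₁ × E h s₂))
lemma6 G =
    (λ _ _ → tree-edge-covered _≟_ TH-tree Γv-path
               (λ a b → G-connected (inj₁ a) (inj₁ b)))
  , (λ _ _ → tree-edge-covered _≟_ TV-tree Γh-path
               (λ a b → gmap swap (λ {x} {y} → BipAdj-swap E {x} {y})
                          (G-connected (inj₂ a) (inj₂ b))))
  where open TreePathIntersectionGraph G
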